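{- For a prime $p$, all $n,k\ge1$, $\pi\in\Pi_n$ and $\gamma\in\Pi_k$: $H_p(\pi\otimes\gamma)=H_p(\pi)+H_p(\gamma)$.
   Context: $\Pi_n=\{\pi\in(\mathbb{Z}/p\mathbb{Z})^n:\sum_i\pi_i=1\}$; $H_p(\pi)=\frac1p(1-\sum_ia_i^p)\in\mathbb{Z}/p\mathbb{Z}$ with $a_i\in\mathbb{Z}$ representing $\pi_i$. The tensor product is $\pi\otimes\gamma=(\pi_1\gamma_1,\dots,\pi_1\gamma_k,\dots,\pi_n\gamma_1,\dots,\pi_n\gamma_k)\in\Pi_{nk}$. -}

module Defs where

open import Data.Nat using (ℕ; NonZero; _^_)
open import Data.Nat.DivMod using (_mod_; _%_)
open import Data.Fin using (Fin; toℕ)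
open import Data.Vec using (Vec; map; concat; sum)
open import Data.Product using (Σ)
open import Data.Integer using (ℤ; +_; _-_)
open import Data.Integer.DivMod using (_/ℕ_; _%ℕ_)
open import Relation.Binary.PropositionalEquality using (_≡_)

-- Z/pZ is modelled by Fin p (canonical representatives 0..p-1).

Π : (p : ℕ) .{{_ : NonZero p}} → ℕ → Set
Π p n = Σ (Vec (Fin p) n) (λ v → sum (map toℕ v) % p ≡ 1 % p)

_·[_]_ : {p : ℕ} → Fin p → (q : ℕ) .{{_ : NonZero q}} → Fin p → Fin q
a ·[ q ] b = (toℕ a Data.Nat.* toℕ b) mod q

tensor : (p : ℕ) .{{_ : NonZero p}} → {n k : ℕ} →
         Vec (Fin p) n → Vec (Fin p) k → Vec (Fin p) (n Data.Nat.* k)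
tensor p π γ = concat (map (λ x → map (λ y → x ·[ p ] y) γ) π)

-- H_p(π) = (1 - Σ a_i^p) / p  reduced mod p, with a_i = toℕ π_i ∈ {0..p-1}
-- (the division is exact for π ∈ Π_n by Fermat's little theorem).
H : (p : ℕ) .{{_ : NonZero p}} → {n : ℕ} → Vec (Fin p) n → ℕ
H p π = ((+ 1 - + sum (map (λ a → toℕ a ^ p) π)) /ℕ p) %ℕ p

{-# OPTIONS --safe #-}
module Submission where

-- Write S(π) = Σ πᵢᵖ over representatives in [0, p), so that H_p(π) is the residue of (1 - S(π))/p.
-- By Fermat, S(π) ≡ Σ πᵢ ≡ 1 (mod p).  Since a ≡ b (mod p) implies aᵖ ≡ bᵖ (mod p²), reducing πᵢγⱼ
-- modulo p does not change its p-th power modulo p², hence S(π ⊗ γ) ≡ S(π) S(γ) (mod p²).  Finally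
-- (1 - ab)/p = (1 - a)/p + (1 - b)/p - p ((1 - a)/p) ((1 - b)/p) for a ≡ b ≡ 1 (mod p).

open import Defs
open import Data.Nat using (ℕ; NonZero; _≥_)
open import Data.Nat.DivMod using (_%_)
open import Data.Nat.Primality using (Prime)
open import Data.Product using (proj₁)
open import Relation.Binary.PropositionalEquality using (_≡_)

module _ where

  open import Data.Nat as ℕ using (zero; suc; _<_)
  import Data.Nat.Properties as ℕ
  import Data.Nat.Divisibility as ℕ∣
  open import Data.Nat.Primality using (euclidsLemma; prime⇒nonZero)
  open import Data.Nat.Combinatorics using (_C_; nCn≡1; nC1≡n; nCk+nC[k+1]≡[n+1]C[k+1]; k>n⇒nCk≡0)
  open import Data.Nat.DivMod using (m%n<n; m%n%n≡m%n)
  import Data.Nat.Tactic.RingSolver as ℕSolver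
  open import Data.Integer as ℤ using (ℤ; +_; -[1+_]; _+_; _*_; _-_; -_; _^_; 1ℤ; 0ℤ)
  import Data.Integer.Properties as ℤ
  open import Data.Integer.DivMod using (_/ℕ_; _%ℕ_; a≡a%ℕn+[a/ℕn]*n; n%ℕd<d)
  open import Data.Integer.Divisibility.Signed
    using (_∣_; divides; ∣ᵤ⇒∣; ∣m∣n⇒∣m+n; ∣m∣n⇒∣m-n; ∣m⇒∣-m; ∣n⇒∣m*n; ∣m⇒∣m*n; *-monoʳ-∣; *-monoˡ-∣; *-cancelˡ-∣; ∣-trans; ∣-refl)
  open import Data.Integer.Tactic.RingSolver using (solve-∀)
  import Algebra.Properties.CommutativeSemiring.Binomial ℤ.+-*-commutativeSemiring as Binomial
  import Algebra.Properties.Monoid.Sum ℤ.+-0-monoid as ℤSum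
  open import Algebra.Definitions.RawMonoid ℤ.+-0-rawMonoid using () renaming (_×_ to _×ₙ_)
  open import Algebra.Properties.Semiring.Exp ℤ.+-*-semiring using () renaming (_^_ to _^ₛ_)
  open import Data.Fin as Fin using (Fin; toℕ; fromℕ; inject₁)
  import Data.Fin.Properties as Fin
  open import Data.Vec using (Vec; []; _∷_; map; concat; sum; _++_)
  open import Data.Vec.Properties using (map-∘; map-cong; map-++; sum-++)
  open import Data.Product using (_×_; _,_; proj₂)
  open import Data.Sum using (inj₁; inj₂)
  open import Relation.Nullary using (contradiction)
  open import Relation.Binary.PropositionalEquality hiding (_≡_)

  infix 4 _≡_mod_
  record _≡_mod_ (x y m : ℤ) : Set where
    constructor congruent
    field m∣x-y : m ∣ x - y

  module _ {m : ℤ} where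

    ≡⇒≡-mod : ∀ {x y} → x ≡ y → x ≡ y mod m
    ≡⇒≡-mod {x} refl = congruent (divides 0ℤ (trans (ℤ.+-inverseʳ x) (sym (ℤ.*-zeroˡ m))))

    ≡-mod-sym : ∀ {x y} → x ≡ y mod m → y ≡ x mod m
    ≡-mod-sym {x} {y} (congruent m∣x-y) = congruent (subst (m ∣_) (lemma x y) (∣m⇒∣-m m∣x-y))
      where lemma : ∀ x y → - (x - y) ≡ y - x
            lemma = solve-∀

    ≡-mod-trans : ∀ {x y z} → x ≡ y mod m → y ≡ z mod m → x ≡ z mod m
    ≡-mod-trans {x} {y} {z} (congruent m∣x-y) (congruent m∣y-z) =
      congruent (subst (m ∣_) (lemma x y z) (∣m∣n⇒∣m+n m∣x-y m∣y-z))
      where lemma : ∀ x y z → (x - y) + (y - z) ≡ x - z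
            lemma = solve-∀

    +-cong-mod : ∀ {x y u v} → x ≡ y mod m → u ≡ v mod m → x + u ≡ y + v mod m
    +-cong-mod {x} {y} {u} {v} (congruent m∣x-y) (congruent m∣u-v) =
      congruent (subst (m ∣_) (lemma x y u v) (∣m∣n⇒∣m+n m∣x-y m∣u-v))
      where lemma : ∀ x y u v → (x - y) + (u - v) ≡ (x + u) - (y + v)
            lemma = solve-∀

    *-cong-mod : ∀ {x y u v} → x ≡ y mod m → u ≡ v mod m → x * u ≡ y * v mod m
    *-cong-mod {x} {y} {u} {v} (congruent m∣x-y) (congruent m∣u-v) =
      congruent (subst (m ∣_) (lemma x y u v) (∣m∣n⇒∣m+n (∣n⇒∣m*n x m∣u-v) (∣m⇒∣m*n v m∣x-y)))
      where lemma : ∀ x y u v → x * (u - v) + (x - y) * v ≡ x * u - y * v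
            lemma = solve-∀

    ≡-mod-+-multiple : ∀ {x t} → m ∣ t → x + t ≡ x mod m
    ≡-mod-+-multiple {x} {t} m∣t = congruent (subst (m ∣_) (lemma x t) m∣t)
      where lemma : ∀ x t → t ≡ x + t - x
            lemma = solve-∀

    ≡-mod-resp-∣ : ∀ {n x y} → m ∣ n → x ≡ y mod n → x ≡ y mod m
    ≡-mod-resp-∣ m∣n (congruent n∣x-y) = congruent (∣-trans m∣n n∣x-y)

  module _ {d : ℕ} .{{_ : NonZero d}} where

    private
      residue≢residue+multiple : ∀ {r s} n → r < d → + r ≢ + s + + suc n * + d
      residue≢residue+multiple {r} {s} n r<d eq = ℕ.<⇒≱ r<d (begin
        d                 ≤⟨ ℕ.m≤m+n d (n ℕ.* d) ⟩
        suc n ℕ.* d       ≤⟨ ℕ.m≤n+m _ s ⟩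
        s ℕ.+ suc n ℕ.* d ≡⟨ ℤ.+-injective eq′ ⟨
        r                 ∎)
        where
          open ℕ.≤-Reasoning
          eq′ : + r ≡ + (s ℕ.+ suc n ℕ.* d)
          eq′ = trans eq (trans (cong (_+_ (+ s)) (sym (ℤ.pos-* (suc n) d))) (sym (ℤ.pos-+ s _)))

      multiple-between-residues≡0 : ∀ {r s} k → r < d → s < d → + r ≡ + s + k * + d → k ≡ 0ℤ
      multiple-between-residues≡0 (+ zero)   _   _   _  = refl
      multiple-between-residues≡0 (+ suc n) r<d _   eq = contradiction eq (residue≢residue+multiple n r<d)
      multiple-between-residues≡0 {r} {s} -[1+ n ] _ s<d eq =
        contradiction (trans (lemma (+ s) (+ suc n) (+ d)) (cong (_+ + suc n * + d) (sym eq)))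
                      (residue≢residue+multiple n s<d)
        where lemma : ∀ s k d → s ≡ s + (- k) * d + k * d
              lemma = solve-∀

    /ℕ-%ℕ-unique : ∀ {x t r} → r < d → x ≡ + r + t * + d → x %ℕ d ≡ r × x /ℕ d ≡ t
    /ℕ-%ℕ-unique {x} {t} {r} r<d x≡r+td = sym (ℤ.+-injective r≡x%d) , x/d≡t
      where
        D = + d
        r′ = x %ℕ d
        q = x /ℕ d

        r≡r′+[q-t]d : + r ≡ + r′ + (q - t) * D
        r≡r′+[q-t]d = begin
          + r                  ≡⟨ lemma₁ (+ r) t D ⟩
          (+ r + t * D) - t * D ≡⟨ cong (_- t * D) (sym x≡r+td) ⟩
          x - t * D            ≡⟨ cong (_- t * D) (a≡a%ℕn+[a/ℕn]*n x d) ⟩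
          (+ r′ + q * D) - t * D ≡⟨ lemma₂ (+ r′) q t D ⟩
          + r′ + (q - t) * D   ∎
          where
            open ≡-Reasoning
            lemma₁ : ∀ r t d → r ≡ (r + t * d) - t * d
            lemma₁ = solve-∀
            lemma₂ : ∀ r q t d → (r + q * d) - t * d ≡ r + (q - t) * d
            lemma₂ = solve-∀

        q-t≡0 : q - t ≡ 0ℤ
        q-t≡0 = multiple-between-residues≡0 (q - t) r<d (n%ℕd<d x d) r≡r′+[q-t]d

        r≡x%d : + r ≡ + r′
        r≡x%d = trans r≡r′+[q-t]d (trans (cong (λ k → + r′ + k * D) q-t≡0) (ℤ.+-identityʳ (+ r′)))

        x/d≡t : q ≡ t
        x/d≡t = trans (lemma q t) (trans (cong (_+ t) q-t≡0) (ℤ.+-identityˡ t))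
          where lemma : ∀ q t → q ≡ (q - t) + t
                lemma = solve-∀

    ≡-mod-%ℕ : ∀ x → x ≡ + (x %ℕ d) mod + d
    ≡-mod-%ℕ x = congruent (divides (x /ℕ d)
      (trans (cong (_- + (x %ℕ d)) (a≡a%ℕn+[a/ℕn]*n x d)) (lemma (+ (x %ℕ d)) (x /ℕ d) (+ d))))
      where lemma : ∀ r q d → (r + q * d) - r ≡ q * d
            lemma = solve-∀

    %ℕ≡⇒≡-mod : ∀ {x y} → x %ℕ d ≡ y %ℕ d → x ≡ y mod + d
    %ℕ≡⇒≡-mod {x} {y} eq =
      ≡-mod-trans (≡-mod-%ℕ x) (subst (λ r → + r ≡ y mod + d) (sym eq) (≡-mod-sym (≡-mod-%ℕ y)))

    ≡-mod⇒%ℕ≡ : ∀ {x y} → x ≡ y mod + d → x %ℕ d ≡ y %ℕ d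
    ≡-mod⇒%ℕ≡ {x} {y} (congruent (divides k x-y≡kd)) =
      sym (proj₁ (/ℕ-%ℕ-unique {t = x /ℕ d - k} (n%ℕd<d x d) y≡r+[q-k]d))
      where
        y≡r+[q-k]d : y ≡ + (x %ℕ d) + (x /ℕ d - k) * + d
        y≡r+[q-k]d = begin
          y                                   ≡⟨ lemma₁ x y ⟩
          x - (x - y)                         ≡⟨ cong₂ _-_ (a≡a%ℕn+[a/ℕn]*n x d) x-y≡kd ⟩
          (+ (x %ℕ d) + (x /ℕ d) * + d) - k * + d ≡⟨ lemma₂ (+ (x %ℕ d)) (x /ℕ d) k (+ d) ⟩
          + (x %ℕ d) + (x /ℕ d - k) * + d     ∎
          where
            open ≡-Reasoning
            lemma₁ : ∀ x y → y ≡ x - (x - y)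
            lemma₁ = solve-∀
            lemma₂ : ∀ r q k d → (r + q * d) - k * d ≡ r + (q - k) * d
            lemma₂ = solve-∀

    /ℕ≡quotient : ∀ {x} (d∣x : + d ∣ x) → x /ℕ d ≡ _∣_.quotient d∣x
    /ℕ≡quotient {x} (divides q x≡qd) =
      proj₂ (/ℕ-%ℕ-unique (ℕ.>-nonZero⁻¹ d) (trans x≡qd (sym (ℤ.+-identityˡ (q * + d)))))

    %ℕ-distrib-+ : ∀ x y → (x + y) %ℕ d ≡ (x %ℕ d ℕ.+ y %ℕ d) % d
    %ℕ-distrib-+ x y = ≡-mod⇒%ℕ≡ (+-cong-mod (≡-mod-%ℕ x) (≡-mod-%ℕ y))

  -- H p π unfolds to defect p (+ powerSum p π).
  defect : (d : ℕ) .{{_ : NonZero d}} → ℤ → ℕ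
  defect d x = ((1ℤ - x) /ℕ d) %ℕ d

  module _ {d : ℕ} .{{_ : NonZero d}} where

    private
      D = + d

      ≡1-quotient : ∀ {x} (d∣1-x : D ∣ 1ℤ - x) → x ≡ 1ℤ - _∣_.quotient d∣1-x * D
      ≡1-quotient {x} (divides h 1-x≡hD) = trans (lemma x) (cong (_-_ 1ℤ) 1-x≡hD)
        where lemma : ∀ x → x ≡ 1ℤ - (1ℤ - x)
              lemma = solve-∀

      quotient-difference : ∀ {a b x} h₁ h₂ w → a ≡ 1ℤ - h₁ * D → b ≡ 1ℤ - h₂ * D → x ≡ 1ℤ - w * D →
                            - (x - a * b) - h₁ * h₂ * (D * D) ≡ D * (w - (h₁ + h₂))
      quotient-difference h₁ h₂ w refl refl refl = lemma h₁ h₂ w D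
        where lemma : ∀ h₁ h₂ w D → - ((1ℤ - w * D) - (1ℤ - h₁ * D) * (1ℤ - h₂ * D)) - h₁ * h₂ * (D * D)
                                    ≡ D * (w - (h₁ + h₂))
              lemma = solve-∀

    defect-* : ∀ {a b x} → 1ℤ ≡ a mod D → 1ℤ ≡ b mod D → x ≡ a * b mod D * D →
               defect d x ≡ (defect d a ℕ.+ defect d b) % d
    defect-* {a} {b} {x} 1≡a@(congruent d∣1-a) 1≡b@(congruent d∣1-b) x≡ab@(congruent dd∣x-ab) = begin
      defect d x                             ≡⟨ cong (_%ℕ d) (/ℕ≡quotient d∣1-x) ⟩
      w %ℕ d                                 ≡⟨ ≡-mod⇒%ℕ≡ w≡h₁+h₂ ⟩
      (h₁ + h₂) %ℕ d                         ≡⟨ %ℕ-distrib-+ h₁ h₂ ⟩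
      (h₁ %ℕ d ℕ.+ h₂ %ℕ d) % d              ≡⟨ cong₂ (λ u v → (u %ℕ d ℕ.+ v %ℕ d) % d) (/ℕ≡quotient d∣1-a) (/ℕ≡quotient d∣1-b) ⟨
      (defect d a ℕ.+ defect d b) % d        ∎
      where
        open ≡-Reasoning
        h₁ = _∣_.quotient d∣1-a
        h₂ = _∣_.quotient d∣1-b
        d∣1-x : D ∣ 1ℤ - x
        d∣1-x = _≡_mod_.m∣x-y
          (≡-mod-trans (*-cong-mod 1≡a 1≡b) (≡-mod-sym (≡-mod-resp-∣ (∣m⇒∣m*n D ∣-refl) x≡ab)))
        w = _∣_.quotient d∣1-x
        w≡h₁+h₂ : w ≡ h₁ + h₂ mod D
        w≡h₁+h₂ = congruent (*-cancelˡ-∣ D (subst (D * D ∣_)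
          (quotient-difference {a} {b} {x} h₁ h₂ w (≡1-quotient d∣1-a) (≡1-quotient d∣1-b) (≡1-quotient d∣1-x))
          (∣m∣n⇒∣m-n (∣m⇒∣-m dd∣x-ab) (∣n⇒∣m*n (h₁ * h₂) ∣-refl))))

  pos-^ : ∀ m n → + (m ℕ.^ n) ≡ (+ m) ^ n
  pos-^ m zero    = refl
  pos-^ m (suc n) = trans (ℤ.pos-* m (m ℕ.^ n)) (cong (_*_ (+ m)) (pos-^ m n))

  ^-distribʳ-* : ∀ x y n → (x * y) ^ n ≡ x ^ n * y ^ n
  ^-distribʳ-* x y zero    = refl
  ^-distribʳ-* x y (suc n) = trans (cong (_*_ (x * y)) (^-distribʳ-* x y n)) (lemma x y (x ^ n) (y ^ n))
    where lemma : ∀ x y X Y → x * y * (X * Y) ≡ x * X * (y * Y)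
          lemma = solve-∀

  +-^-first-order : ∀ y e n → (y + e) ^ suc n ≡ y ^ suc n + + suc n * y ^ n * e mod e * e
  +-^-first-order y e zero    = ≡⇒≡-mod (lemma y e)
    where lemma : ∀ y e → (y + e) * 1ℤ ≡ y * 1ℤ + 1ℤ * 1ℤ * e
          lemma = solve-∀
  +-^-first-order y e (suc n) with +-^-first-order y e n
  ... | congruent e²∣IH = congruent (subst (e * e ∣_)
          (lemma y e ((y + e) ^ suc n) (y ^ n) (+ suc n))
          (∣m∣n⇒∣m+n (∣n⇒∣m*n (y + e) e²∣IH) (∣n⇒∣m*n (+ suc n * y ^ n) ∣-refl)))
    where lemma : ∀ y e Z Y K → (y + e) * (Z - (y * Y + K * Y * e)) + K * Y * (e * e)
                              ≡ (y + e) * Z - (y * (y * Y) + (1ℤ + K) * (y * Y) * e)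
          lemma = solve-∀

  ^-lift : ∀ m {x y} → x ≡ y mod + m → x ^ m ≡ y ^ m mod + m * + m
  ^-lift zero    _ = ≡⇒≡-mod refl
  ^-lift (suc n) {x} {y} (congruent m∣e) =
    ≡-mod-trans (≡-mod-resp-∣ M²∣e² expansion)
                (≡-mod-+-multiple (subst (M * M ∣_) (lemma₂ M (y ^ n) e) (∣n⇒∣m*n (y ^ n) (*-monoʳ-∣ M m∣e))))
    where
      M = + suc n
      e = x - y
      M²∣e² : M * M ∣ e * e
      M²∣e² = ∣-trans (*-monoʳ-∣ M m∣e) (*-monoˡ-∣ e m∣e)
      lemma₁ : ∀ x y → y + (x - y) ≡ x
      lemma₁ = solve-∀
      expansion : x ^ suc n ≡ y ^ suc n + M * y ^ n * e mod e * e
      expansion = subst (λ z → z ^ suc n ≡ y ^ suc n + M * y ^ n * e mod e * e) (lemma₁ x y) (+-^-first-order y e n)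
      lemma₂ : ∀ M Y e → Y * (M * e) ≡ M * Y * e
      lemma₂ = solve-∀

  [1+k]*[1+n]C[1+k]≡[1+n]*nCk : ∀ n k → suc k ℕ.* (suc n C suc k) ≡ suc n ℕ.* (n C k)
  [1+k]*[1+n]C[1+k]≡[1+n]*nCk n zero = begin
    1 ℕ.* (suc n C 1) ≡⟨ ℕ.*-identityˡ _ ⟩
    suc n C 1         ≡⟨ nC1≡n (suc n) ⟩
    suc n             ≡⟨ ℕ.*-identityʳ (suc n) ⟨
    suc n ℕ.* 1       ∎
    where open ≡-Reasoning
  [1+k]*[1+n]C[1+k]≡[1+n]*nCk zero (suc k) = begin
    suc (suc k) ℕ.* (1 C suc (suc k)) ≡⟨ cong (suc (suc k) ℕ.*_) (k>n⇒nCk≡0 {1} {suc (suc k)} (ℕ.s<s ℕ.z<s)) ⟩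
    suc (suc k) ℕ.* 0                 ≡⟨ ℕ.*-zeroʳ (suc (suc k)) ⟩
    0                                 ≡⟨ cong (1 ℕ.*_) (k>n⇒nCk≡0 {0} {suc k} ℕ.z<s) ⟨
    1 ℕ.* (0 C suc k)                 ∎
    where open ≡-Reasoning
  [1+k]*[1+n]C[1+k]≡[1+n]*nCk (suc n) (suc k) = begin
    (2 ℕ.+ k) ℕ.* (suc (suc n) C (2 ℕ.+ k))
      ≡⟨ cong ((2 ℕ.+ k) ℕ.*_) (nCk+nC[k+1]≡[n+1]C[k+1] (suc n) (suc k)) ⟨
    (2 ℕ.+ k) ℕ.* (c₁ ℕ.+ c₂)
      ≡⟨ lemma₁ k c₁ c₂ ⟩
    c₁ ℕ.+ suc k ℕ.* c₁ ℕ.+ (2 ℕ.+ k) ℕ.* c₂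
      ≡⟨ cong₂ (λ u v → c₁ ℕ.+ u ℕ.+ v) ([1+k]*[1+n]C[1+k]≡[1+n]*nCk n k) ([1+k]*[1+n]C[1+k]≡[1+n]*nCk n (suc k)) ⟩
    c₁ ℕ.+ suc n ℕ.* (n C k) ℕ.+ suc n ℕ.* (n C suc k)
      ≡⟨ lemma₂ c₁ (suc n) (n C k) (n C suc k) ⟩
    c₁ ℕ.+ suc n ℕ.* (n C k ℕ.+ n C suc k)
      ≡⟨ cong (λ u → c₁ ℕ.+ suc n ℕ.* u) (nCk+nC[k+1]≡[n+1]C[k+1] n k) ⟩
    c₁ ℕ.+ suc n ℕ.* c₁ ∎
    where
      open ≡-Reasoning
      c₁ = suc n C suc k
      c₂ = suc n C suc (suc k)
      lemma₁ : ∀ k c₁ c₂ → (2 ℕ.+ k) ℕ.* (c₁ ℕ.+ c₂) ≡ c₁ ℕ.+ suc k ℕ.* c₁ ℕ.+ (2 ℕ.+ k) ℕ.* c₂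
      lemma₁ = ℕSolver.solve-∀
      lemma₂ : ∀ c n a b → c ℕ.+ n ℕ.* a ℕ.+ n ℕ.* b ≡ c ℕ.+ n ℕ.* (a ℕ.+ b)
      lemma₂ = ℕSolver.solve-∀

  p∣pCk : ∀ {p k} → Prime p → 0 < k → k < p → p ℕ∣.∣ p C k
  p∣pCk {suc n} {suc k} pr _ k<p
    with euclidsLemma (suc k) (suc n C suc k) pr
           (ℕ∣.divides (n C k) (trans ([1+k]*[1+n]C[1+k]≡[1+n]*nCk n k) (ℕ.*-comm (suc n) (n C k))))
  ... | inj₁ p∣k  = contradiction (ℕ∣.∣⇒≤ p∣k) (ℕ.<⇒≱ k<p)
  ... | inj₂ p∣pCk = p∣pCk

  ×ₙ≡pos-* : ∀ n x → n ×ₙ x ≡ + n * x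
  ×ₙ≡pos-* zero    x = sym (ℤ.*-zeroˡ x)
  ×ₙ≡pos-* (suc n) x = trans (cong (_+_ x) (×ₙ≡pos-* n x)) (lemma x (+ n))
    where lemma : ∀ x n → x + n * x ≡ (1ℤ + n) * x
          lemma = solve-∀

  ^ₛ≡^ : ∀ x n → x ^ₛ n ≡ x ^ n
  ^ₛ≡^ x zero    = refl
  ^ₛ≡^ x (suc n) = cong (_*_ x) (^ₛ≡^ x n)

  ∣-sum : ∀ {m n} (f : Fin n → ℤ) → (∀ i → m ∣ f i) → m ∣ ℤSum.sum f
  ∣-sum {n = zero}  f _   = divides 0ℤ refl
  ∣-sum {n = suc n} f m∣f =
    ∣m∣n⇒∣m+n (m∣f Fin.zero) (∣-sum (λ i → f (Fin.suc i)) (λ i → m∣f (Fin.suc i)))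

  freshman's-dream : ∀ {p} → Prime p → ∀ x y → (x + y) ^ p ≡ x ^ p + y ^ p mod + p
  freshman's-dream {zero}      pr = contradiction refl (ℕ.≢-nonZero⁻¹ 0 {{prime⇒nonZero pr}})
  freshman's-dream {p@(suc q)} pr x y =
    congruent (subst (+ p ∣_) (sym binomial-middle) (∣-sum middle p∣middle))
    where
      term : Fin (suc p) → ℤ
      term = Binomial.binomialTerm x y p

      middle : Fin q → ℤ
      middle i = term (Fin.suc (inject₁ i))

      p∣middle : ∀ i → + p ∣ middle i
      p∣middle i =
        subst (+ p ∣_) (sym (×ₙ≡pos-* (p C k) z)) (∣m⇒∣m*n z (∣ᵤ⇒∣ {+ p} {+ (p C k)} (p∣pCk pr ℕ.z<s k<p)))
        where
          z = Binomial.binomial x y p (Fin.suc (inject₁ i))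
          k = suc (toℕ (inject₁ i))
          k<p : k < p
          k<p = ℕ.s<s (subst (_< q) (sym (Fin.toℕ-inject₁ i)) (Fin.toℕ<n i))

      binomial-middle : (x + y) ^ p - (x ^ p + y ^ p) ≡ ℤSum.sum middle
      binomial-middle = begin
        (x + y) ^ p - (x ^ p + y ^ p)
          ≡⟨ cong (_- (x ^ p + y ^ p)) (trans (sym (^ₛ≡^ (x + y) p)) (Binomial.theorem p x y)) ⟩
        (term Fin.zero + ℤSum.sum (λ i → term (Fin.suc i))) - (x ^ p + y ^ p)
          ≡⟨ cong (λ s → (term Fin.zero + s) - (x ^ p + y ^ p)) (ℤSum.sum-init-last (λ i → term (Fin.suc i))) ⟩
        (term Fin.zero + (ℤSum.sum middle + term (fromℕ p))) - (x ^ p + y ^ p)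
          ≡⟨ cong₂ (λ a b → (a + (ℤSum.sum middle + b)) - (x ^ p + y ^ p)) first-term last-term ⟩
        (y ^ p + (ℤSum.sum middle + x ^ p)) - (x ^ p + y ^ p)
          ≡⟨ lemma (ℤSum.sum middle) (x ^ p) (y ^ p) ⟩
        ℤSum.sum middle ∎
        where
          open ≡-Reasoning
          first-term : term Fin.zero ≡ y ^ p
          first-term = trans (ℤ.+-identityʳ _) (trans (ℤ.*-identityˡ _) (^ₛ≡^ y p))
          last-term : term (fromℕ p) ≡ x ^ p
          last-term rewrite Fin.toℕ-fromℕ q | nCn≡1 p | ℕ.n∸n≡0 q =
            trans (ℤ.+-identityʳ _) (trans (ℤ.*-identityʳ _) (^ₛ≡^ x p))
          lemma : ∀ s a b → (b + (s + a)) - (a + b) ≡ s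
          lemma = solve-∀

  fermat's-little-theorem : ∀ {p} → Prime p → ∀ a → (+ a) ^ p ≡ + a mod + p
  fermat's-little-theorem {zero}  pr _       = contradiction refl (ℕ.≢-nonZero⁻¹ 0 {{prime⇒nonZero pr}})
  fermat's-little-theorem {suc q} pr zero    = ≡⇒≡-mod refl
  fermat's-little-theorem {suc q} pr (suc a) =
    ≡-mod-trans (freshman's-dream pr 1ℤ (+ a))
                (+-cong-mod (≡⇒≡-mod (ℤ.^-zeroˡ (suc q))) (fermat's-little-theorem pr a))

  module _ {A : Set} where

    sum-map-cong-mod : ∀ {m n} (f g : A → ℕ) → (∀ a → + f a ≡ + g a mod m) → (v : Vec A n) →
                       + sum (map f v) ≡ + sum (map g v) mod m
    sum-map-cong-mod f g f≡g []      = ≡⇒≡-mod refl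
    sum-map-cong-mod f g f≡g (a ∷ v) = +-cong-mod (f≡g a) (sum-map-cong-mod f g f≡g v)

    sum-map-concat : ∀ {B : Set} {n k} (f : B → ℕ) (g : A → Vec B k) (v : Vec A n) →
                     sum (map f (concat (map g v))) ≡ sum (map (λ a → sum (map f (g a))) v)
    sum-map-concat f g []      = refl
    sum-map-concat f g (a ∷ v) = begin
      sum (map f (g a ++ concat (map g v)))                ≡⟨ cong sum (map-++ f (g a) (concat (map g v))) ⟩
      sum (map f (g a) ++ map f (concat (map g v)))        ≡⟨ sum-++ (map f (g a)) ⟩
      sum (map f (g a)) ℕ.+ sum (map f (concat (map g v))) ≡⟨ cong (sum (map f (g a)) ℕ.+_) (sum-map-concat f g v) ⟩
      sum (map f (g a)) ℕ.+ sum (map (λ a → sum (map f (g a))) v) ∎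
      where open ≡-Reasoning

    *-distribʳ-sum-map : ∀ {n} (f : A → ℕ) c (v : Vec A n) → sum (map f v) ℕ.* c ≡ sum (map (λ a → f a ℕ.* c) v)
    *-distribʳ-sum-map f c []      = refl
    *-distribʳ-sum-map f c (a ∷ v) =
      trans (ℕ.*-distribʳ-+ c (f a) _) (cong (f a ℕ.* c ℕ.+_) (*-distribʳ-sum-map f c v))

    *-distribˡ-sum-map : ∀ {n} (f : A → ℕ) c (v : Vec A n) → c ℕ.* sum (map f v) ≡ sum (map (λ a → c ℕ.* f a) v)
    *-distribˡ-sum-map f c v =
      trans (ℕ.*-comm c _) (trans (*-distribʳ-sum-map f c v) (cong sum (map-cong (λ a → ℕ.*-comm (f a) c) v)))

  sum-map-*-sum-map : ∀ {A B : Set} {n k} (f : A → ℕ) (g : B → ℕ) (v : Vec A n) (w : Vec B k) →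
                      sum (map f v) ℕ.* sum (map g w) ≡ sum (map (λ a → sum (map (λ b → f a ℕ.* g b) w)) v)
  sum-map-*-sum-map f g v w =
    trans (*-distribʳ-sum-map f _ v) (cong sum (map-cong (λ a → *-distribˡ-sum-map g (f a) w) v))

  powerSum : (p : ℕ) {n : ℕ} → Vec (Fin p) n → ℕ
  powerSum p v = sum (map (λ a → toℕ a ℕ.^ p) v)

  module _ {p : ℕ} .{{_ : NonZero p}} where

    1≡powerSum : ∀ {n} → Prime p → (π : Π p n) → 1ℤ ≡ + powerSum p (proj₁ π) mod + p
    1≡powerSum pr (v , Σv≡1) =
      ≡-mod-sym (≡-mod-trans (sum-map-cong-mod _ toℕ fermat v)
                             (%ℕ≡⇒≡-mod {x = + sum (map toℕ v)} {y = 1ℤ} Σv≡1))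
      where
        fermat : ∀ a → + (toℕ a ℕ.^ p) ≡ + toℕ a mod + p
        fermat a = subst (_≡ + toℕ a mod + p) (sym (pos-^ (toℕ a) p)) (fermat's-little-theorem pr (toℕ a))

    ·-^-≡-mod : ∀ (a b : Fin p) → + (toℕ (a ·[ p ] b) ℕ.^ p) ≡ + (toℕ a ℕ.^ p ℕ.* toℕ b ℕ.^ p) mod + p * + p
    ·-^-≡-mod a b = subst₂ (λ u v → u ≡ v mod + p * + p) reduced-power product-power
      (^-lift p (%ℕ≡⇒≡-mod {x = + (c % p)} {y = + c} (m%n%n≡m%n c p)))
      where
        c = toℕ a ℕ.* toℕ b
        reduced-power : (+ (c % p)) ^ p ≡ + (toℕ (a ·[ p ] b) ℕ.^ p)
        reduced-power =
          trans (sym (pos-^ (c % p) p)) (cong (λ r → + (r ℕ.^ p)) (sym (Fin.toℕ-fromℕ< (m%n<n c p))))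
        product-power : (+ c) ^ p ≡ + (toℕ a ℕ.^ p ℕ.* toℕ b ℕ.^ p)
        product-power = begin
          (+ c) ^ p                         ≡⟨ cong (_^ p) (ℤ.pos-* (toℕ a) (toℕ b)) ⟩
          (+ toℕ a * + toℕ b) ^ p           ≡⟨ ^-distribʳ-* (+ toℕ a) (+ toℕ b) p ⟩
          (+ toℕ a) ^ p * (+ toℕ b) ^ p     ≡⟨ cong₂ _*_ (pos-^ (toℕ a) p) (pos-^ (toℕ b) p) ⟨
          + (toℕ a ℕ.^ p) * + (toℕ b ℕ.^ p) ≡⟨ ℤ.pos-* (toℕ a ℕ.^ p) (toℕ b ℕ.^ p) ⟨
          + (toℕ a ℕ.^ p ℕ.* toℕ b ℕ.^ p)   ∎
          where open ≡-Reasoning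

    powerSum-tensor : ∀ {n k} (v : Vec (Fin p) n) (w : Vec (Fin p) k) →
                      + powerSum p (tensor p v w) ≡ + powerSum p v * + powerSum p w mod + p * + p
    powerSum-tensor v w = subst₂ (λ s t → s ≡ t mod + p * + p)
      (cong +_ (sym tensor-sum))
      (trans (cong +_ (sym product-sum)) (ℤ.pos-* (powerSum p v) (powerSum p w)))
      (sum-map-cong-mod _ _ (λ a → sum-map-cong-mod _ _ (·-^-≡-mod a) w) v)
      where
        f : Fin p → ℕ
        f a = toℕ a ℕ.^ p
        tensor-sum : powerSum p (tensor p v w) ≡ sum (map (λ a → sum (map (λ b → f (a ·[ p ] b)) w)) v)
        tensor-sum = trans (sum-map-concat f (λ a → map (λ b → a ·[ p ] b) w) v)
                           (cong sum (map-cong (λ a → cong sum (sym (map-∘ f (λ b → a ·[ p ] b) w))) v))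
        product-sum : powerSum p v ℕ.* powerSum p w ≡ sum (map (λ a → sum (map (λ b → f a ℕ.* f b) w)) v)
        product-sum = sum-map-*-sum-map f f v w

-- Opened only now: the development above uses ℤ's _+_.
open import Data.Nat using (_+_)

corollary4p2 : (p : ℕ) .{{_ : NonZero p}} → Prime p →
    (n k : ℕ) → n ≥ 1 → k ≥ 1 → (π : Π p n) → (γ : Π p k) →
    H p (tensor p (proj₁ π) (proj₁ γ)) ≡ (H p (proj₁ π) + H p (proj₁ γ)) % p
corollary4p2 p pr n k _ _ π γ =
  defect-* (1≡powerSum pr π) (1≡powerSum pr γ) (powerSum-tensor (proj₁ π) (proj₁ γ))
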